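{- Let $r$ be a power of a prime, $k=\mathbb{F}_r(T)$, and let $\Pi$ denote the Carlitz factorial. Let $\{AC_n\}_{n\ge0}$ be a sequence in $k$ with $AC_0=1$, put $S(z)=\sum_{n=0}^\infty \frac{AC_n}{\Pi(n)}z^n\in k[[z]]$, and write $\frac{1}{S(z)}=\sum_{n=0}^\infty \lambda_n z^n$. For $\ell\in\mathbb{N}$ define $AC_n^{(\ell)}\in k$ by $(S(z))^\ell=\sum_{n=0}^\infty \frac{AC_n^{(\ell)}}{\Pi(n)}z^n$, and for $e\ge0$ put $D_\ell(e)=\sum_{i_1+\cdots+i_\ell=e,\ i_1,\dots,i_\ell\ge0}\lambda_{i_1}\cdots\lambda_{i_\ell}$. Then for every $m\ge1$, $$AC_m^{(\ell)}=(-1)^m\Pi(m)\det\begin{pmatrix} D_\ell(1)&1&&&\\ D_\ell(2)&D_\ell(1)&\ddots&&\\ \vdots&\vdots&\ddots&\ddots&\\ D_\ell(m-1)&D_\ell(m-2)&\cdots&D_\ell(1)&1\\ D_\ell(m)&D_\ell(m-1)&\cdots&D_\ell(2)&D_\ell(1) \end{pmatrix},$$ the $m\times m$ matrix whose $(i,j)$ entry is $D_\ell(i-j+1)$ for $i\ge j$, $1$ for $j=i+1$, and $0$ for $j>i+1$.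
   Context: For $i\ge1$ let $[i]=T^{r^i}-T$, and let $D_i=[i][i-1]^r\cdots[1]^{r^{i-1}}$ with $D_0=1$. For a nonnegative integer $n$ with base-$r$ expansion $n=\sum_{j=0}^m c_jr^j$ ($0\le c_j<r$), the Carlitz factorial is $\Pi(n)=\prod_{j=0}^m D_j^{c_j}$ (a nonzero element of $k$). -}

module Defs where

open import Level using (Level; _⊔_) renaming (suc to lsuc)
open import Algebra.Bundles using (CommutativeRing)
open import Data.Nat using (ℕ; zero; suc; _≤_; _^_; _∸_; _/_; _%_; _≤ᵇ_; _≡ᵇ_)
open import Data.Nat.Primality using (Prime)
open import Data.Fin as Fin using (Fin; toℕ; punchIn)
open import Data.List using (List; []; _∷_; map)
open import Data.Bool using (if_then_else_)
open import Data.Product using (∃; _×_; _,_)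
open import Function using (_∘_)
open import Relation.Nullary using (¬_)
open import Relation.Binary.PropositionalEquality using (_≡_)

IsPrimePower : ℕ → Set
IsPrimePower r = ∃ λ p → ∃ λ a → Prime p × 1 ≤ a × r ≡ p ^ a

-- A finite field with exactly r elements (this is F_r, unique up to isomorphism).
-- Equality on the carrier is the setoid equality _≈_ of the ring.
record FiniteField (c ℓ : Level) (r : ℕ) : Set (lsuc (c ⊔ ℓ)) where
  field
    commRing : CommutativeRing c ℓ
  open CommutativeRing commRing public
  field
    0≉1       : ¬ (0# ≈ 1#)
    inverse   : ∀ x → ¬ (x ≈ 0#) → ∃ λ y → x * y ≈ 1#
    enum      : Fin r → Carrier
    enum-surj : ∀ x → ∃ λ i → enum i ≈ x
    enum-inj  : ∀ i j → enum i ≈ enum j → i ≡ j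

-- base-r quotient / remainder (r = 0 never occurs for a prime power)
divR : ℕ → ℕ → ℕ
divR n zero    = 0
divR n (suc k) = n / suc k

modR : ℕ → ℕ → ℕ
modR n zero    = n
modR n (suc k) = n % suc k

module Carlitz {c ℓ : Level} (r : ℕ) (F : FiniteField c ℓ r) where
  open FiniteField F

  -- Polynomials F_r[T] as coefficient lists (constant term first)
  Poly : Set c
  Poly = List Carrier

  coeff : Poly → ℕ → Carrier
  coeff []      n       = 0#
  coeff (a ∷ p) zero    = a
  coeff (a ∷ p) (suc n) = coeff p n

  _≈P_ : Poly → Poly → Set ℓ
  p ≈P q = ∀ n → coeff p n ≈ coeff q n

  0P 1P TP : Poly
  0P = []
  1P = 1# ∷ []
  TP = 0# ∷ 1# ∷ []

  _+P_ : Poly → Poly → Poly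
  []      +P q       = q
  (a ∷ p) +P []      = a ∷ p
  (a ∷ p) +P (b ∷ q) = (a + b) ∷ (p +P q)

  -P_ : Poly → Poly
  -P p = map -_ p

  _*P_ : Poly → Poly → Poly
  []      *P q = []
  (a ∷ p) *P q = map (a *_) q +P (0# ∷ (p *P q))

  _^P_ : Poly → ℕ → Poly
  p ^P zero  = 1P
  p ^P suc n = p *P (p ^P n)

  bracket : ℕ → Poly
  bracket i = (TP ^P (r ^ i)) +P (-P TP)

  -- D_0 = 1, D_i = [i] [i-1]^r ... [1]^{r^{i-1}} = [i] · D_{i-1}^r
  Dpoly : ℕ → Poly
  Dpoly zero    = 1P
  Dpoly (suc i) = bracket (suc i) *P (Dpoly i ^P r)

  -- Π(n) = ∏_j D_j^{c_j}, n = Σ c_j r^j; first argument is fuel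
  -- (fuel n+1 exceeds the number of base-r digits; further digits are 0)
  Πaux : ℕ → ℕ → ℕ → Poly
  Πaux zero    j n = 1P
  Πaux (suc f) j n = (Dpoly j ^P modR n r) *P Πaux f (suc j) (divR n r)

  CarlitzΠ : ℕ → Poly
  CarlitzΠ n = Πaux (suc n) 0 n

  -- k = F_r(T): fractions num/den of polynomials
  record K : Set c where
    constructor _/ₖ_
    field
      num : Poly
      den : Poly
  open K public

  Valid : K → Set ℓ
  Valid x = ¬ (den x ≈P 0P)

  _≈K_ : K → K → Set ℓ
  x ≈K y = (num x *P den y) ≈P (num y *P den x)

  0K 1K : K
  0K = 0P /ₖ 1P
  1K = 1P /ₖ 1P

  _+K_ : K → K → K
  x +K y = ((num x *P den y) +P (num y *P den x)) /ₖ (den x *P den y)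

  _*K_ : K → K → K
  x *K y = (num x *P num y) /ₖ (den x *P den y)

  -K_ : K → K
  -K x = (-P num x) /ₖ den x

  -- inverse (used only for the nonzero elements Π(n))
  invK : K → K
  invK x = den x /ₖ num x

  polyK : Poly → K
  polyK p = p /ₖ 1P

  Πk : ℕ → K
  Πk n = polyK (CarlitzΠ n)

  negOnePow : ℕ → K
  negOnePow zero    = 1K
  negOnePow (suc n) = -K negOnePow n

  Σ≤ : ℕ → (ℕ → K) → K
  Σ≤ zero    f = f 0
  Σ≤ (suc n) f = Σ≤ n f +K f (suc n)

  PS : Set c
  PS = ℕ → K

  unitPS : PS
  unitPS zero    = 1K
  unitPS (suc n) = 0K

  _*PS_ : PS → PS → PS
  (a *PS b) n = Σ≤ n (λ i → a i *K b (n ∸ i))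

  _^PS_ : PS → ℕ → PS
  a ^PS zero  = unitPS
  a ^PS suc l = a *PS (a ^PS l)

  Sser : (ℕ → K) → PS
  Sser AC n = AC n *K invK (Πk n)

  -- D_ℓ(e) = Σ_{i_1+…+i_ℓ=e} λ_{i_1}⋯λ_{i_ℓ}, the sum organised by i_1:
  -- D_0(e) = [e = 0],  D_{ℓ+1}(e) = Σ_{i=0}^{e} λ_i D_ℓ(e - i)
  Dℓ : (ℕ → K) → ℕ → ℕ → K
  Dℓ lam zero    zero    = 1K
  Dℓ lam zero    (suc e) = 0K
  Dℓ lam (suc l) e       = Σ≤ e (λ i → lam i *K Dℓ lam l (e ∸ i))

  ΣFin : ∀ {m} → (Fin m → K) → K
  ΣFin {zero}  f = 0K
  ΣFin {suc m} f = f Fin.zero +K ΣFin (f ∘ Fin.suc)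

  det : ∀ m → (Fin m → Fin m → K) → K
  det zero    A = 1K
  det (suc m) A =
    ΣFin (λ j → negOnePow (toℕ j) *K
                 (A Fin.zero j *K det m (λ i k → A (Fin.suc i) (punchIn j k))))

  hessMatrix : (ℕ → K) → ∀ m → Fin m → Fin m → K
  hessMatrix d m i j =
    if toℕ j ≤ᵇ toℕ i then d (suc (toℕ i ∸ toℕ j))
    else (if toℕ j ≡ᵇ suc (toℕ i) then 1K else 0K)

module Submission where

-- Since Π(n) is a non-zero element of k, the hypothesis on AC⁽ˡ⁾ says that the series
-- Σ AC⁽ˡ⁾ₙ / Π(n) zⁿ is S(z)^ℓ, whose inverse is (1/S(z))^ℓ = Σ D_ℓ(e) zᵉ. For any
-- series g with g₀ = 1, the coefficients of 1/g are fₘ = (-1)ᵐ det Hₘ(g), Hₘ(g) the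
-- Hessenberg matrix of the statement: expanding det Hₘ(g) along its first row yields
-- the recursion f₍ₙ₊₁₎ = -Σₖ g₍ₖ₊₁₎ f₍ₙ₋ₖ₎ that g ⋆ f = 1 imposes. This is proved over
-- an arbitrary commutative ring, and k is realised as the fractions of F_r[T] with
-- non-zero denominator, on which cross-multiplication is an equivalence because
-- F_r[T] has no zero divisors.

open import Level using (Level; _⊔_)
open import Algebra.Bundles using (CommutativeRing; CommutativeMonoid)
import Algebra.Properties.CommutativeMonoid.Mult
open import Data.Bool using (true; false; if_then_else_)
open import Data.Empty using (⊥-elim)
open import Data.Fin as Fin using (Fin; toℕ; punchIn)
open import Data.List using ([]; _∷_; map)
open import Data.Nat as ℕ using (ℕ; zero; suc; _∸_; _≤_; _<_; z≤n; s≤s; _≤ᵇ_; _≡ᵇ_)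
open import Data.Nat.Induction using (<-rec)
open import Data.Nat.Primality using (prime⇒nonZero; prime⇒nonTrivial)
import Data.Nat.Properties as ℕₚ
open import Data.Product using (Σ; _×_; _,_; proj₁)
open import Function using (_∘_)
open import Relation.Binary.Definitions using (tri<; tri≈; tri>)
open import Relation.Binary.PropositionalEquality as ≡ using (_≡_; _≢_)
open import Relation.Nullary using (¬_; Dec; yes; no)

open import Defs

module FormalPowerSeries {a b : Level} (R : CommutativeRing a b) where
  open CommutativeRing R hiding (zero)
  open import Algebra.Properties.Ring ring using (-‿+-comm)
  open import Relation.Binary.Reasoning.Setoid setoid

  Σ≤ : ℕ → (ℕ → Carrier) → Carrier
  Σ≤ zero    f = f 0
  Σ≤ (suc n) f = Σ≤ n f + f (suc n)

  Σ≤-cong : ∀ n {f g : ℕ → Carrier} → (∀ i → i ≤ n → f i ≈ g i) → Σ≤ n f ≈ Σ≤ n g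
  Σ≤-cong zero    f≈g = f≈g 0 z≤n
  Σ≤-cong (suc n) f≈g = +-cong (Σ≤-cong n (λ i i≤n → f≈g i (ℕₚ.m≤n⇒m≤1+n i≤n))) (f≈g (suc n) ℕₚ.≤-refl)

  Σ≤-distrib-+ : ∀ n f g → Σ≤ n (λ i → f i + g i) ≈ Σ≤ n f + Σ≤ n g
  Σ≤-distrib-+ zero    f g = refl
  Σ≤-distrib-+ (suc n) f g = trans (+-congʳ (Σ≤-distrib-+ n f g)) (interchange _ _ _ _)
    where open import Algebra.Properties.CommutativeSemigroup +-commutativeSemigroup using (interchange)

  *-distribˡ-Σ≤ : ∀ n c f → c * Σ≤ n f ≈ Σ≤ n (λ i → c * f i)
  *-distribˡ-Σ≤ zero    c f = refl
  *-distribˡ-Σ≤ (suc n) c f = trans (distribˡ c _ _) (+-congʳ (*-distribˡ-Σ≤ n c f))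

  *-distribʳ-Σ≤ : ∀ n c f → Σ≤ n f * c ≈ Σ≤ n (λ i → f i * c)
  *-distribʳ-Σ≤ zero    c f = refl
  *-distribʳ-Σ≤ (suc n) c f = trans (distribʳ c _ _) (+-congʳ (*-distribʳ-Σ≤ n c f))

  -‿distrib-Σ≤ : ∀ n f → - Σ≤ n f ≈ Σ≤ n (λ i → - f i)
  -‿distrib-Σ≤ zero    f = refl
  -‿distrib-Σ≤ (suc n) f = trans (sym (-‿+-comm _ _)) (+-congʳ (-‿distrib-Σ≤ n f))

  Σ≤-zero : ∀ n f → (∀ i → i ≤ n → f i ≈ 0#) → Σ≤ n f ≈ 0#
  Σ≤-zero zero    f f≈0 = f≈0 0 z≤n
  Σ≤-zero (suc n) f f≈0 =
    trans (+-cong (Σ≤-zero n f (λ i i≤n → f≈0 i (ℕₚ.m≤n⇒m≤1+n i≤n))) (f≈0 (suc n) ℕₚ.≤-refl)) (+-identityʳ 0#)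

  Σ≤-suc : ∀ n f → Σ≤ (suc n) f ≈ f 0 + Σ≤ n (f ∘ suc)
  Σ≤-suc zero    f = refl
  Σ≤-suc (suc n) f = trans (+-congʳ (Σ≤-suc n f)) (+-assoc _ _ _)

  Σ≤-reverse : ∀ n f → Σ≤ n f ≈ Σ≤ n (λ i → f (n ∸ i))
  Σ≤-reverse zero    f = refl
  Σ≤-reverse (suc n) f = sym (begin
    Σ≤ (suc n) (λ i → f (suc n ∸ i))    ≈⟨ Σ≤-suc n _ ⟩
    f (suc n) + Σ≤ n (λ i → f (n ∸ i))  ≈⟨ +-congˡ (Σ≤-reverse n f) ⟨
    f (suc n) + Σ≤ n f                  ≈⟨ +-comm _ _ ⟩
    Σ≤ n f + f (suc n)                  ∎)

  Σ≤-single : ∀ n k f → k ≤ n → (∀ i → i ≤ n → i ≢ k → f i ≈ 0#) → Σ≤ n f ≈ f k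
  Σ≤-single zero    .zero f z≤n f≈0 = refl
  Σ≤-single (suc n) k     f k≤1+n f≈0 with k ℕ.≟ suc n
  ... | yes ≡.refl = trans (+-congʳ (Σ≤-zero n f (λ i i≤n → f≈0 i (ℕₚ.m≤n⇒m≤1+n i≤n) (ℕₚ.<⇒≢ (s≤s i≤n)))))
                           (+-identityˡ _)
  ... | no k≢1+n = trans (+-cong (Σ≤-single n k f (ℕₚ.≤-pred (ℕₚ.≤∧≢⇒< k≤1+n k≢1+n))
                                     (λ i i≤n → f≈0 i (ℕₚ.m≤n⇒m≤1+n i≤n)))
                                 (f≈0 (suc n) ℕₚ.≤-refl (k≢1+n ∘ ≡.sym)))
                         (+-identityʳ _)

  Σ≤-triangle : ∀ n (F : ℕ → ℕ → Carrier) →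
                Σ≤ n (λ i → Σ≤ i (F i)) ≈ Σ≤ n (λ j → Σ≤ (n ∸ j) (λ k → F (j ℕ.+ k) j))
  Σ≤-triangle zero    F = refl
  Σ≤-triangle (suc n) F = sym (begin
    Σ≤ n (λ j → Σ≤ (suc n ∸ j) (column j)) + Σ≤ (n ∸ n) (column (suc n))
      ≈⟨ +-cong (Σ≤-cong n column-suc) lastColumn ⟩
    Σ≤ n (λ j → Σ≤ (n ∸ j) (column j) + F (suc n) j) + F (suc n) (suc n)
      ≈⟨ +-congʳ (Σ≤-distrib-+ n _ _) ⟩
    (Σ≤ n (λ j → Σ≤ (n ∸ j) (column j)) + Σ≤ n (F (suc n))) + F (suc n) (suc n)
      ≈⟨ +-assoc _ _ _ ⟩
    Σ≤ n (λ j → Σ≤ (n ∸ j) (column j)) + Σ≤ (suc n) (F (suc n))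
      ≈⟨ +-congʳ (Σ≤-triangle n F) ⟨
    Σ≤ n (λ i → Σ≤ i (F i)) + Σ≤ (suc n) (F (suc n)) ∎)
    where
    column : ℕ → ℕ → Carrier
    column j k = F (j ℕ.+ k) j

    column-suc : ∀ j → j ≤ n → Σ≤ (suc n ∸ j) (column j) ≈ Σ≤ (n ∸ j) (column j) + F (suc n) j
    column-suc j j≤n = trans (reflexive (≡.cong (λ t → Σ≤ t (column j)) (ℕₚ.+-∸-assoc 1 j≤n)))
      (+-congˡ (reflexive (≡.cong (λ t → F t j) (≡.trans (ℕₚ.+-suc j (n ∸ j)) (≡.cong suc (ℕₚ.m+[n∸m]≡n j≤n))))))

    lastColumn : Σ≤ (n ∸ n) (column (suc n)) ≈ F (suc n) (suc n)
    lastColumn = trans (reflexive (≡.cong (λ t → Σ≤ t (column (suc n))) (ℕₚ.n∸n≡0 n)))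
                       (reflexive (≡.cong (λ t → F t (suc n)) (ℕₚ.+-identityʳ (suc n))))

  Series : Set a
  Series = ℕ → Carrier

  infix 4 _≐_
  _≐_ : Series → Series → Set b
  f ≐ g = ∀ n → f n ≈ g n

  one : Series
  one zero    = 1#
  one (suc n) = 0#

  infixl 7 _⋆_
  _⋆_ : Series → Series → Series
  (f ⋆ g) n = Σ≤ n (λ i → f i * g (n ∸ i))

  ⋆-cong : ∀ {f f′ g g′} → f ≐ f′ → g ≐ g′ → f ⋆ g ≐ f′ ⋆ g′
  ⋆-cong f≐f′ g≐g′ n = Σ≤-cong n (λ i _ → *-cong (f≐f′ i) (g≐g′ (n ∸ i)))

  ⋆-comm : ∀ f g → f ⋆ g ≐ g ⋆ f
  ⋆-comm f g n = begin
    Σ≤ n (λ i → f i * g (n ∸ i))              ≈⟨ Σ≤-reverse n _ ⟩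
    Σ≤ n (λ i → f (n ∸ i) * g (n ∸ (n ∸ i)))  ≈⟨ Σ≤-cong n (λ i i≤n → trans (*-comm _ _)
                                                   (*-congʳ (reflexive (≡.cong g (ℕₚ.m∸[m∸n]≡n i≤n))))) ⟩
    Σ≤ n (λ i → g i * f (n ∸ i))              ∎

  ⋆-identityʳ : ∀ f → f ⋆ one ≐ f
  ⋆-identityʳ f n = begin
    Σ≤ n (λ i → f i * one (n ∸ i))  ≈⟨ Σ≤-single n n _ ℕₚ.≤-refl (λ i i≤n i≢n → vanish (ℕₚ.≤∧≢⇒< i≤n i≢n)) ⟩
    f n * one (n ∸ n)               ≈⟨ *-congˡ (reflexive (≡.cong one (ℕₚ.n∸n≡0 n))) ⟩
    f n * 1#                        ≈⟨ *-identityʳ _ ⟩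
    f n                             ∎
    where
    vanish : ∀ {i} → i < n → f i * one (n ∸ i) ≈ 0#
    vanish {i} i<n with n ∸ i | ℕₚ.m<n⇒0<n∸m i<n
    ... | suc _ | _ = zeroʳ _

  ⋆-identityˡ : ∀ f → one ⋆ f ≐ f
  ⋆-identityˡ f n = trans (⋆-comm one f n) (⋆-identityʳ f n)

  ⋆-assoc : ∀ f g h → (f ⋆ g) ⋆ h ≐ f ⋆ (g ⋆ h)
  ⋆-assoc f g h n = begin
    Σ≤ n (λ i → Σ≤ i (λ j → f j * g (i ∸ j)) * h (n ∸ i))
      ≈⟨ Σ≤-cong n (λ i _ → *-distribʳ-Σ≤ i _ _) ⟩
    Σ≤ n (λ i → Σ≤ i (λ j → (f j * g (i ∸ j)) * h (n ∸ i)))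
      ≈⟨ Σ≤-triangle n _ ⟩
    Σ≤ n (λ j → Σ≤ (n ∸ j) (λ k → (f j * g ((j ℕ.+ k) ∸ j)) * h (n ∸ (j ℕ.+ k))))
      ≈⟨ Σ≤-cong n (λ j _ → Σ≤-cong (n ∸ j) (λ k _ → trans (*-assoc _ _ _) (*-congˡ (*-cong
           (reflexive (≡.cong g (ℕₚ.m+n∸m≡n j k))) (reflexive (≡.cong h (≡.sym (ℕₚ.∸-+-assoc n j k)))))))) ⟩
    Σ≤ n (λ j → Σ≤ (n ∸ j) (λ k → f j * (g k * h ((n ∸ j) ∸ k))))
      ≈⟨ Σ≤-cong n (λ j _ → *-distribˡ-Σ≤ (n ∸ j) _ _) ⟨
    Σ≤ n (λ j → f j * Σ≤ (n ∸ j) (λ k → g k * h ((n ∸ j) ∸ k))) ∎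

  inverse-head : ∀ {f g} → f ⋆ g ≐ one → f 0 ≈ 1# → g 0 ≈ 1#
  inverse-head {f} {g} f⋆g≐one f₀≈1 = begin
    g 0         ≈⟨ *-identityˡ _ ⟨
    1# * g 0    ≈⟨ *-congʳ f₀≈1 ⟨
    f 0 * g 0   ≈⟨ f⋆g≐one 0 ⟩
    1#          ∎

  ⋆-commutativeMonoid : CommutativeMonoid a b
  ⋆-commutativeMonoid = record
    { Carrier = Series ; _≈_ = _≐_ ; _∙_ = _⋆_ ; ε = one
    ; isCommutativeMonoid = record
      { isMonoid = record
        { isSemigroup = record
          { isMagma = record
            { isEquivalence = record { refl = λ _ → refl ; sym = λ p n → sym (p n) ; trans = λ p q n → trans (p n) (q n) }
            ; ∙-cong = λ {f} {f′} {g} {g′} → ⋆-cong {f} {f′} {g} {g′} }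
          ; assoc = ⋆-assoc }
        ; identity = ⋆-identityˡ , ⋆-identityʳ }
      ; comm = ⋆-comm } }

  module ⋆-Power = Algebra.Properties.CommutativeMonoid.Mult ⋆-commutativeMonoid

  infixr 8 _^⋆_
  _^⋆_ : Series → ℕ → Series
  f ^⋆ l = l ⋆-Power.× f

  ^⋆-cong : ∀ l {f g} → f ≐ g → f ^⋆ l ≐ g ^⋆ l
  ^⋆-cong l = ⋆-Power.×-congʳ l

  ^⋆-distrib-⋆ : ∀ f g l → (f ⋆ g) ^⋆ l ≐ f ^⋆ l ⋆ g ^⋆ l
  ^⋆-distrib-⋆ f g l = ⋆-Power.×-distrib-+ f g l

  one-^⋆ : ∀ l → one ^⋆ l ≐ one
  one-^⋆ zero      = λ _ → refl
  one-^⋆ (suc l) n = trans (⋆-cong {one} {one} {one ^⋆ l} {one} (λ _ → refl) (one-^⋆ l) n) (⋆-identityʳ one n)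

  ^⋆-inverse : ∀ {f g} → f ⋆ g ≐ one → ∀ l → g ^⋆ l ⋆ f ^⋆ l ≐ one
  ^⋆-inverse {f} {g} f⋆g≐one l n = begin
    (g ^⋆ l ⋆ f ^⋆ l) n  ≈⟨ ⋆-comm (g ^⋆ l) (f ^⋆ l) n ⟩
    (f ^⋆ l ⋆ g ^⋆ l) n  ≈⟨ ^⋆-distrib-⋆ f g l n ⟨
    ((f ⋆ g) ^⋆ l) n     ≈⟨ ^⋆-cong l {f ⋆ g} {one} f⋆g≐one n ⟩
    (one ^⋆ l) n         ≈⟨ one-^⋆ l n ⟩
    one n                ∎

  ^⋆-head : ∀ f l → f 0 ≈ 1# → (f ^⋆ l) 0 ≈ 1#
  ^⋆-head f zero    f₀≈1 = refl
  ^⋆-head f (suc l) f₀≈1 = trans (*-cong f₀≈1 (^⋆-head f l f₀≈1)) (*-identityʳ 1#)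

module HessenbergDeterminants {a b : Level} (R : CommutativeRing a b) where
  open CommutativeRing R hiding (zero)
  open FormalPowerSeries R
  open import Algebra.Properties.Ring ring using (-‿distribˡ-*; -‿distribʳ-*; -‿involutive; +-inverseˡ-unique)
  open import Algebra.Properties.CommutativeSemigroup *-commutativeSemigroup using (xy∙z≈y∙zx; x∙yz≈y∙xz)
  open import Relation.Binary.Reasoning.Setoid setoid

  negOnePow : ℕ → Carrier
  negOnePow zero    = 1#
  negOnePow (suc n) = - negOnePow n

  negOnePow-+ : ∀ m n → negOnePow (m ℕ.+ n) ≈ negOnePow m * negOnePow n
  negOnePow-+ zero    n = sym (*-identityˡ _)
  negOnePow-+ (suc m) n = trans (-‿cong (negOnePow-+ m n)) (-‿distribˡ-* _ _)

  negOnePow-square : ∀ k → negOnePow k * negOnePow k ≈ 1#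
  negOnePow-square zero    = *-identityˡ 1#
  negOnePow-square (suc k) = begin
    - negOnePow k * - negOnePow k     ≈⟨ -‿distribˡ-* _ _ ⟨
    - (negOnePow k * - negOnePow k)   ≈⟨ -‿cong (-‿distribʳ-* _ _) ⟨
    - - (negOnePow k * negOnePow k)   ≈⟨ -‿involutive _ ⟩
    negOnePow k * negOnePow k         ≈⟨ negOnePow-square k ⟩
    1#                                ∎

  negOnePow-∸ : ∀ {k n} → k ≤ n → negOnePow n * negOnePow k ≈ negOnePow (n ∸ k)
  negOnePow-∸ {k} {n} k≤n = begin
    negOnePow n * negOnePow k                        ≈⟨ *-congʳ (reflexive (≡.cong negOnePow (ℕₚ.m+[n∸m]≡n k≤n))) ⟨
    negOnePow (k ℕ.+ (n ∸ k)) * negOnePow k          ≈⟨ *-congʳ (negOnePow-+ k (n ∸ k)) ⟩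
    (negOnePow k * negOnePow (n ∸ k)) * negOnePow k  ≈⟨ xy∙z≈y∙zx _ _ _ ⟩
    negOnePow (n ∸ k) * (negOnePow k * negOnePow k)  ≈⟨ *-congˡ (negOnePow-square k) ⟩
    negOnePow (n ∸ k) * 1#                           ≈⟨ *-identityʳ _ ⟩
    negOnePow (n ∸ k)                                ∎

  ΣFin : ∀ {m} → (Fin m → Carrier) → Carrier
  ΣFin {zero}  f = 0#
  ΣFin {suc m} f = f Fin.zero + ΣFin (f ∘ Fin.suc)

  ΣFin-cong : ∀ {m} {f g : Fin m → Carrier} → (∀ i → f i ≈ g i) → ΣFin f ≈ ΣFin g
  ΣFin-cong {zero}  f≈g = refl
  ΣFin-cong {suc m} f≈g = +-cong (f≈g Fin.zero) (ΣFin-cong (f≈g ∘ Fin.suc))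

  ΣFin-zero : ∀ {m} (f : Fin m → Carrier) → (∀ i → f i ≈ 0#) → ΣFin f ≈ 0#
  ΣFin-zero {zero}  f f≈0 = refl
  ΣFin-zero {suc m} f f≈0 = trans (+-cong (f≈0 Fin.zero) (ΣFin-zero (f ∘ Fin.suc) (f≈0 ∘ Fin.suc))) (+-identityʳ 0#)

  Matrix : ℕ → Set a
  Matrix m = Fin m → Fin m → Carrier

  det : ∀ m → Matrix m → Carrier
  det zero    A = 1#
  det (suc m) A =
    ΣFin (λ j → negOnePow (toℕ j) * (A Fin.zero j * det m (λ i k → A (Fin.suc i) (punchIn j k))))

  det-cong : ∀ m {A B : Matrix m} → (∀ i j → A i j ≈ B i j) → det m A ≈ det m B
  det-cong zero    A≈B = refl
  det-cong (suc m) A≈B = ΣFin-cong (λ j → *-congˡ {negOnePow (toℕ j)} (*-cong (A≈B Fin.zero j)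
                           (det-cong m (λ i k → A≈B (Fin.suc i) (punchIn j k)))))

  hessenbergEntry : Series → ℕ → ℕ → Carrier
  hessenbergEntry h i j = if j ≤ᵇ i then h (suc (i ∸ j)) else (if j ≡ᵇ suc i then 1# else 0#)

  hessenbergEntry-suc : ∀ h i j → hessenbergEntry h (suc i) (suc j) ≡ hessenbergEntry h i j
  hessenbergEntry-suc h i zero    = ≡.refl
  hessenbergEntry-suc h i (suc j) = ≡.refl

  hessenberg : Series → ∀ m → Matrix m
  hessenberg h m i j = hessenbergEntry h (toℕ i) (toℕ j)

  hessenbergDet : Series → ℕ → Carrier
  hessenbergDet h m = det m (hessenberg h m)

  -- The Hessenberg matrix of h is the case v = h ∘ suc.
  hessenbergWithColumn : Series → Series → ∀ m → Matrix m
  hessenbergWithColumn h v m i Fin.zero    = v (toℕ i)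
  hessenbergWithColumn h v m i (Fin.suc j) = hessenbergEntry h (toℕ i) (suc (toℕ j))

  -- Along the first row only the entries v 0 and 1 survive; deleting the
  -- column of that 1 leaves a matrix of the same shape with v shifted.
  det-hessenbergWithColumn-suc : ∀ h v m →
    det (suc (suc m)) (hessenbergWithColumn h v (suc (suc m)))
      ≈ v 0 * hessenbergDet h (suc m) + - det (suc m) (hessenbergWithColumn h (v ∘ suc) (suc m))
  det-hessenbergWithColumn-suc h v m =
    +-cong (trans (*-identityˡ _) (*-congˡ (det-cong (suc m) {minorOfHead} {hessenberg h (suc m)} λ i k →
             reflexive (hessenbergEntry-suc h (toℕ i) (toℕ k)))))
           (trans (+-cong cofactorOfOne (ΣFin-zero _ laterCofactors)) (+-identityʳ _))
    where
    minorOfHead minorOfOne : Matrix (suc m)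
    minorOfHead i k = hessenbergWithColumn h v (suc (suc m)) (Fin.suc i) (Fin.suc k)
    minorOfOne  i k = hessenbergWithColumn h v (suc (suc m)) (Fin.suc i) (punchIn (Fin.suc Fin.zero) k)

    laterCofactors : ∀ (j : Fin m) → negOnePow (suc (suc (toℕ j))) *
                       (hessenbergEntry h 0 (suc (suc (toℕ j))) *
                        det (suc m) (λ i k → hessenbergWithColumn h v (suc (suc m)) (Fin.suc i) (punchIn (Fin.suc (Fin.suc j)) k)))
                       ≈ 0#
    laterCofactors j = trans (*-congˡ (zeroˡ _)) (zeroʳ _)

    cofactorOfOne : negOnePow 1 * (1# * det (suc m) minorOfOne) ≈ - det (suc m) (hessenbergWithColumn h (v ∘ suc) (suc m))
    cofactorOfOne = trans (sym (-‿distribˡ-* _ _)) (-‿cong (trans (*-identityˡ _) (trans (*-identityˡ _)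
      (det-cong (suc m) {minorOfOne} {hessenbergWithColumn h (v ∘ suc) (suc m)}
        λ { i Fin.zero → refl ; i (Fin.suc k) → reflexive (hessenbergEntry-suc h (toℕ i) (suc (toℕ k))) }))))

  det-hessenbergWithColumn : ∀ h m v →
    det (suc m) (hessenbergWithColumn h v (suc m)) ≈ Σ≤ m (λ k → negOnePow k * (v k * hessenbergDet h (m ∸ k)))
  det-hessenbergWithColumn h zero    v = +-identityʳ _
  det-hessenbergWithColumn h (suc m) v = begin
    det (suc (suc m)) (hessenbergWithColumn h v (suc (suc m)))
      ≈⟨ det-hessenbergWithColumn-suc h v m ⟩
    v 0 * hessenbergDet h (suc m) + - det (suc m) (hessenbergWithColumn h (v ∘ suc) (suc m))
      ≈⟨ +-cong (sym (*-identityˡ _)) (-‿cong (det-hessenbergWithColumn h m (v ∘ suc))) ⟩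
    negOnePow 0 * (v 0 * hessenbergDet h (suc m)) + - Σ≤ m (λ k → negOnePow k * (v (suc k) * hessenbergDet h (m ∸ k)))
      ≈⟨ +-congˡ (trans (-‿distrib-Σ≤ m _) (Σ≤-cong m λ _ _ → -‿distribˡ-* _ _)) ⟩
    negOnePow 0 * (v 0 * hessenbergDet h (suc m)) + Σ≤ m (λ k → negOnePow (suc k) * (v (suc k) * hessenbergDet h (m ∸ k)))
      ≈⟨ Σ≤-suc m _ ⟨
    Σ≤ (suc m) (λ k → negOnePow k * (v k * hessenbergDet h (suc m ∸ k))) ∎

  hessenbergDet-suc : ∀ h m → hessenbergDet h (suc m) ≈ Σ≤ m (λ k → negOnePow k * (h (suc k) * hessenbergDet h (m ∸ k)))
  hessenbergDet-suc h m =
    trans (det-cong (suc m) {hessenberg h (suc m)} {hessenbergWithColumn h (h ∘ suc) (suc m)}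
             λ { i Fin.zero → refl ; i (Fin.suc j) → refl })
          (det-hessenbergWithColumn h m (h ∘ suc))

  module _ (f g : Series) (g⋆f≐one : g ⋆ f ≐ one) (g₀≈1 : g 0 ≈ 1#) where

    inverse-suc : ∀ n → f (suc n) ≈ - Σ≤ n (λ k → g (suc k) * f (n ∸ k))
    inverse-suc n = begin
      f (suc n)        ≈⟨ *-identityˡ _ ⟨
      1# * f (suc n)   ≈⟨ *-congʳ g₀≈1 ⟨
      g 0 * f (suc n)  ≈⟨ +-inverseˡ-unique _ _ (trans (sym (Σ≤-suc n _)) (g⋆f≐one (suc n))) ⟩
      - Σ≤ n (λ k → g (suc k) * f (n ∸ k)) ∎

    inverse-hessenbergDet : ∀ m → f m ≈ negOnePow m * hessenbergDet g m
    inverse-hessenbergDet = <-rec _ go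
      where
      go : ∀ m → (∀ {t} → t < m → f t ≈ negOnePow t * hessenbergDet g t) → f m ≈ negOnePow m * hessenbergDet g m
      go zero    _  = trans (inverse-head {g} {f} g⋆f≐one g₀≈1) (sym (*-identityˡ 1#))
      go (suc n) IH = begin
        f (suc n)
          ≈⟨ inverse-suc n ⟩
        - Σ≤ n (λ k → g (suc k) * f (n ∸ k))
          ≈⟨ -‿cong (Σ≤-cong n λ k _ → *-congˡ (IH (s≤s (ℕₚ.m∸n≤m n k)))) ⟩
        - Σ≤ n (λ k → g (suc k) * (negOnePow (n ∸ k) * hessenbergDet g (n ∸ k)))
          ≈⟨ -‿distrib-Σ≤ n _ ⟩
        Σ≤ n (λ k → - (g (suc k) * (negOnePow (n ∸ k) * hessenbergDet g (n ∸ k))))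
          ≈⟨ Σ≤-cong n sign ⟩
        Σ≤ n (λ k → negOnePow (suc n) * (negOnePow k * (g (suc k) * hessenbergDet g (n ∸ k))))
          ≈⟨ *-distribˡ-Σ≤ n _ _ ⟨
        negOnePow (suc n) * Σ≤ n (λ k → negOnePow k * (g (suc k) * hessenbergDet g (n ∸ k)))
          ≈⟨ *-congˡ (hessenbergDet-suc g n) ⟨
        negOnePow (suc n) * hessenbergDet g (suc n) ∎
        where
        sign : ∀ k → k ≤ n → - (g (suc k) * (negOnePow (n ∸ k) * hessenbergDet g (n ∸ k)))
                              ≈ negOnePow (suc n) * (negOnePow k * (g (suc k) * hessenbergDet g (n ∸ k)))
        sign k k≤n = sym (begin
          - negOnePow n * (negOnePow k * (g (suc k) * hessenbergDet g (n ∸ k)))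
            ≈⟨ *-assoc _ _ _ ⟨
          (- negOnePow n * negOnePow k) * (g (suc k) * hessenbergDet g (n ∸ k))
            ≈⟨ *-congʳ (trans (sym (-‿distribˡ-* _ _)) (-‿cong (negOnePow-∸ k≤n))) ⟩
          - negOnePow (n ∸ k) * (g (suc k) * hessenbergDet g (n ∸ k))
            ≈⟨ -‿distribˡ-* _ _ ⟨
          - (negOnePow (n ∸ k) * (g (suc k) * hessenbergDet g (n ∸ k)))
            ≈⟨ -‿cong (x∙yz≈y∙xz _ _ _) ⟩
          - (g (suc k) * (negOnePow (n ∸ k) * hessenbergDet g (n ∸ k))) ∎)

  ^⋆-inverse-hessenbergDet : ∀ {f g} → f ⋆ g ≐ one → f 0 ≈ 1# →
                             ∀ l m → (f ^⋆ l) m ≈ negOnePow m * hessenbergDet (g ^⋆ l) m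
  ^⋆-inverse-hessenbergDet {f} {g} f⋆g≐one f₀≈1 l =
    inverse-hessenbergDet (f ^⋆ l) (g ^⋆ l) (^⋆-inverse f⋆g≐one l) (^⋆-head g l (inverse-head {f} {g} f⋆g≐one f₀≈1))

-- The ring laws of fractions, each in the cross-multiplied form to which they
-- unfold: a / b ≈ c / d is a * d ≈ c * b.
module CrossMultiplication {a b : Level} (R : CommutativeRing a b) where
  open CommutativeRing R hiding (zero)
  open import Algebra.Solver.Ring.NaturalCoefficients.Default commutativeSemiring using (solve; _:+_; _:*_; _:=_; con)
  open import Algebra.Properties.Ring ring using (-‿distribˡ-*; x∙y⁻¹≈ε⇒x≈y)
  open import Relation.Binary.Reasoning.Setoid setoid

  cross-trans : ∀ {a b c d e f} → (∀ {x} → x * d ≈ 0# → x ≈ 0#) →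
                a * d ≈ c * b → c * f ≈ e * d → a * f ≈ e * b
  cross-trans {a} {b} {c} {d} {e} {f} cancel ad≈cb cf≈ed = x∙y⁻¹≈ε⇒x≈y _ _ (cancel (begin
    (a * f + - (e * b)) * d          ≈⟨ distribʳ d _ _ ⟩
    (a * f) * d + (- (e * b)) * d    ≈⟨ +-cong (begin
        (a * f) * d  ≈⟨ solve 3 (λ a f d → (a :* f) :* d := (a :* d) :* f) refl a f d ⟩
        (a * d) * f  ≈⟨ *-congʳ ad≈cb ⟩
        (c * b) * f  ≈⟨ solve 3 (λ c b f → (c :* b) :* f := (c :* f) :* b) refl c b f ⟩
        (c * f) * b  ≈⟨ *-congʳ cf≈ed ⟩
        (e * d) * b  ≈⟨ solve 3 (λ e d b → (e :* d) :* b := (e :* b) :* d) refl e d b ⟩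
        (e * b) * d  ∎) (sym (-‿distribˡ-* _ _)) ⟩
    (e * b) * d + - ((e * b) * d)    ≈⟨ -‿inverseʳ _ ⟩
    0#                               ∎))

  cross-+-cong : ∀ a b a′ b′ c d c′ d′ → a * b′ ≈ a′ * b → c * d′ ≈ c′ * d →
                 ((a * d) + (c * b)) * (b′ * d′) ≈ ((a′ * d′) + (c′ * b′)) * (b * d)
  cross-+-cong a b a′ b′ c d c′ d′ ab′≈a′b cd′≈c′d = begin
    ((a * d) + (c * b)) * (b′ * d′)
      ≈⟨ solve 6 (λ a b b′ c d d′ → ((a :* d) :+ (c :* b)) :* (b′ :* d′) := (a :* b′) :* (d :* d′) :+ (c :* d′) :* (b :* b′))
               refl a b b′ c d d′ ⟩
    (a * b′) * (d * d′) + (c * d′) * (b * b′)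
      ≈⟨ +-cong (*-congʳ ab′≈a′b) (*-congʳ cd′≈c′d) ⟩
    (a′ * b) * (d * d′) + (c′ * d) * (b * b′)
      ≈⟨ solve 6 (λ a′ b b′ c′ d d′ → (a′ :* b) :* (d :* d′) :+ (c′ :* d) :* (b :* b′) := ((a′ :* d′) :+ (c′ :* b′)) :* (b :* d))
               refl a′ b b′ c′ d d′ ⟩
    ((a′ * d′) + (c′ * b′)) * (b * d) ∎

  cross-*-cong : ∀ a b a′ b′ c d c′ d′ → a * b′ ≈ a′ * b → c * d′ ≈ c′ * d →
                 (a * c) * (b′ * d′) ≈ (a′ * c′) * (b * d)
  cross-*-cong a b a′ b′ c d c′ d′ ab′≈a′b cd′≈c′d = begin
    (a * c) * (b′ * d′)  ≈⟨ solve 4 (λ a c b′ d′ → (a :* c) :* (b′ :* d′) := (a :* b′) :* (c :* d′)) refl a c b′ d′ ⟩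
    (a * b′) * (c * d′)  ≈⟨ *-cong ab′≈a′b cd′≈c′d ⟩
    (a′ * b) * (c′ * d)  ≈⟨ solve 4 (λ a′ b c′ d → (a′ :* b) :* (c′ :* d) := (a′ :* c′) :* (b :* d)) refl a′ b c′ d ⟩
    (a′ * c′) * (b * d)  ∎

  cross-neg-cong : ∀ a b a′ b′ → a * b′ ≈ a′ * b → (- a) * b′ ≈ (- a′) * b
  cross-neg-cong a b a′ b′ ab′≈a′b = trans (sym (-‿distribˡ-* a b′)) (trans (-‿cong ab′≈a′b) (-‿distribˡ-* a′ b))

  cross-+-assoc : ∀ a b c d e f →
    ((((a * d) + (c * b)) * f) + (e * (b * d))) * (b * (d * f))
      ≈ ((a * (d * f)) + (((c * f) + (e * d)) * b)) * ((b * d) * f)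
  cross-+-assoc = solve 6 (λ a b c d e f →
    ((((a :* d) :+ (c :* b)) :* f) :+ (e :* (b :* d))) :* (b :* (d :* f))
      := ((a :* (d :* f)) :+ (((c :* f) :+ (e :* d)) :* b)) :* ((b :* d) :* f)) refl

  cross-+-comm : ∀ a b c d → ((a * d) + (c * b)) * (d * b) ≈ ((c * b) + (a * d)) * (b * d)
  cross-+-comm = solve 4 (λ a b c d → ((a :* d) :+ (c :* b)) :* (d :* b) := ((c :* b) :+ (a :* d)) :* (b :* d)) refl

  cross-+-identityˡ : ∀ a b → ((0# * b) + (a * 1#)) * b ≈ a * (1# * b)
  cross-+-identityˡ = solve 2 (λ a b → ((con 0 :* b) :+ (a :* con 1)) :* b := a :* (con 1 :* b)) refl

  cross-+-identityʳ : ∀ a b → ((a * 1#) + (0# * b)) * b ≈ a * (b * 1#)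
  cross-+-identityʳ = solve 2 (λ a b → ((a :* con 1) :+ (con 0 :* b)) :* b := a :* (b :* con 1)) refl

  cross-neg-inverseˡ : ∀ a b → (((- a) * b) + (a * b)) * 1# ≈ 0# * (b * b)
  cross-neg-inverseˡ a b = begin
    (((- a) * b) + (a * b)) * 1#  ≈⟨ *-identityʳ _ ⟩
    ((- a) * b) + (a * b)         ≈⟨ +-congʳ (-‿distribˡ-* a b) ⟨
    - (a * b) + (a * b)           ≈⟨ -‿inverseˡ _ ⟩
    0#                            ≈⟨ zeroˡ _ ⟨
    0# * (b * b)                  ∎

  cross-neg-inverseʳ : ∀ a b → ((a * b) + ((- a) * b)) * 1# ≈ 0# * (b * b)
  cross-neg-inverseʳ a b = trans (*-congʳ (+-comm _ _)) (cross-neg-inverseˡ a b)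

  cross-*-assoc : ∀ a b c d e f → ((a * c) * e) * (b * (d * f)) ≈ (a * (c * e)) * ((b * d) * f)
  cross-*-assoc = solve 6 (λ a b c d e f → ((a :* c) :* e) :* (b :* (d :* f)) := (a :* (c :* e)) :* ((b :* d) :* f)) refl

  cross-*-identityˡ : ∀ a b → (1# * a) * b ≈ a * (1# * b)
  cross-*-identityˡ = solve 2 (λ a b → (con 1 :* a) :* b := a :* (con 1 :* b)) refl

  cross-*-identityʳ : ∀ a b → (a * 1#) * b ≈ a * (b * 1#)
  cross-*-identityʳ = solve 2 (λ a b → (a :* con 1) :* b := a :* (b :* con 1)) refl

  cross-*-comm : ∀ a b c d → (a * c) * (d * b) ≈ (c * a) * (b * d)
  cross-*-comm = solve 4 (λ a b c d → (a :* c) :* (d :* b) := (c :* a) :* (b :* d)) refl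

  cross-distribˡ : ∀ a b c d e f →
    (a * ((c * f) + (e * d))) * ((b * d) * (b * f)) ≈ (((a * c) * (b * f)) + ((a * e) * (b * d))) * (b * (d * f))
  cross-distribˡ = solve 6 (λ a b c d e f →
    (a :* ((c :* f) :+ (e :* d))) :* ((b :* d) :* (b :* f))
      := (((a :* c) :* (b :* f)) :+ ((a :* e) :* (b :* d))) :* (b :* (d :* f))) refl

  cross-distribʳ : ∀ a b c d e f →
    (((c * f) + (e * d)) * a) * ((d * b) * (f * b)) ≈ (((c * a) * (f * b)) + ((e * a) * (d * b))) * ((d * f) * b)
  cross-distribʳ = solve 6 (λ a b c d e f →
    (((c :* f) :+ (e :* d)) :* a) :* ((d :* b) :* (f :* b))
      := (((c :* a) :* (f :* b)) :+ ((e :* a) :* (d :* b))) :* ((d :* f) :* b)) refl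

module Polynomials {c ℓ : Level} (r : ℕ) (F : FiniteField c ℓ r) where
  open FiniteField F hiding (zero)
  open Carlitz r F
  module Coeff = FormalPowerSeries commRing
  open Coeff using (Σ≤-zero; Σ≤-suc; Σ≤-single; Σ≤-cong; Σ≤-distrib-+; _⋆_; one; ⋆-cong; ⋆-assoc; ⋆-comm; ⋆-identityˡ)
  open import Algebra.Properties.Ring ring using (-0#≈0#)
  open import Algebra.Properties.CommutativeSemigroup *-commutativeSemigroup using (xy∙z≈y∙xz)
  open import Relation.Binary.Reasoning.Setoid setoid

  coeff-+P : ∀ p q n → coeff (p +P q) n ≈ coeff p n + coeff q n
  coeff-+P []      q       n       = sym (+-identityˡ _)
  coeff-+P (a ∷ p) []      n       = sym (+-identityʳ _)
  coeff-+P (a ∷ p) (b ∷ q) zero    = refl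
  coeff-+P (a ∷ p) (b ∷ q) (suc n) = coeff-+P p q n

  coeff-negP : ∀ p n → coeff (-P p) n ≈ - coeff p n
  coeff-negP []      n       = sym -0#≈0#
  coeff-negP (a ∷ p) zero    = refl
  coeff-negP (a ∷ p) (suc n) = coeff-negP p n

  coeff-map-* : ∀ a q n → coeff (map (a *_) q) n ≈ a * coeff q n
  coeff-map-* a []      n       = sym (zeroʳ a)
  coeff-map-* a (b ∷ q) zero    = refl
  coeff-map-* a (b ∷ q) (suc n) = coeff-map-* a q n

  coeff-*P : ∀ p q n → coeff (p *P q) n ≈ (coeff p ⋆ coeff q) n
  coeff-*P []      q n       = sym (Σ≤-zero n _ (λ i _ → zeroˡ _))
  coeff-*P (a ∷ p) q zero    = trans (coeff-+P (map (a *_) q) _ 0) (trans (+-identityʳ _) (coeff-map-* a q 0))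
  coeff-*P (a ∷ p) q (suc n) = begin
    coeff (map (a *_) q +P (0# ∷ (p *P q))) (suc n)  ≈⟨ coeff-+P (map (a *_) q) _ (suc n) ⟩
    coeff (map (a *_) q) (suc n) + coeff (p *P q) n  ≈⟨ +-cong (coeff-map-* a q (suc n)) (coeff-*P p q n) ⟩
    a * coeff q (suc n) + (coeff p ⋆ coeff q) n      ≈⟨ Σ≤-suc n (λ i → coeff (a ∷ p) i * coeff q (suc n ∸ i)) ⟨
    (coeff (a ∷ p) ⋆ coeff q) (suc n)                ∎

  coeff-1P : ∀ n → coeff 1P n ≈ one n
  coeff-1P zero    = refl
  coeff-1P (suc n) = refl

  -- Wrapped in a record so that the implicit arguments of the ring laws can be inferred.
  record _≃P_ (p q : Poly) : Set ℓ where
    constructor ⟨_⟩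
    field coeff-≈ : p ≈P q
  open _≃P_

  +P-cong : ∀ {p p′ q q′} → p ≈P p′ → q ≈P q′ → (p +P q) ≈P (p′ +P q′)
  +P-cong {p} {p′} {q} {q′} p≈p′ q≈q′ n =
    trans (coeff-+P p q n) (trans (+-cong (p≈p′ n) (q≈q′ n)) (sym (coeff-+P p′ q′ n)))

  *P-cong : ∀ {p p′ q q′} → p ≈P p′ → q ≈P q′ → (p *P q) ≈P (p′ *P q′)
  *P-cong {p} {p′} {q} {q′} p≈p′ q≈q′ n =
    trans (coeff-*P p q n) (trans (⋆-cong {coeff p} {coeff p′} {coeff q} {coeff q′} p≈p′ q≈q′ n) (sym (coeff-*P p′ q′ n)))

  *P-assoc : ∀ p q s → ((p *P q) *P s) ≈P (p *P (q *P s))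
  *P-assoc p q s n = begin
    coeff ((p *P q) *P s) n                 ≈⟨ coeff-*P (p *P q) s n ⟩
    (coeff (p *P q) ⋆ coeff s) n            ≈⟨ ⋆-cong {coeff (p *P q)} {coeff p ⋆ coeff q} {coeff s} {coeff s} (coeff-*P p q) (λ _ → refl) n ⟩
    ((coeff p ⋆ coeff q) ⋆ coeff s) n       ≈⟨ ⋆-assoc (coeff p) (coeff q) (coeff s) n ⟩
    (coeff p ⋆ (coeff q ⋆ coeff s)) n       ≈⟨ ⋆-cong {coeff p} {coeff p} {coeff (q *P s)} {coeff q ⋆ coeff s} (λ _ → refl) (coeff-*P q s) n ⟨
    (coeff p ⋆ coeff (q *P s)) n            ≈⟨ coeff-*P p (q *P s) n ⟨
    coeff (p *P (q *P s)) n                 ∎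

  *P-comm : ∀ p q → (p *P q) ≈P (q *P p)
  *P-comm p q n = trans (coeff-*P p q n) (trans (⋆-comm (coeff p) (coeff q) n) (sym (coeff-*P q p n)))

  *P-identityˡ : ∀ p → (1P *P p) ≈P p
  *P-identityˡ p n =
    trans (coeff-*P 1P p n) (trans (⋆-cong {coeff 1P} {one} {coeff p} {coeff p} coeff-1P (λ _ → refl) n) (⋆-identityˡ (coeff p) n))

  *P-distribˡ : ∀ p q s → (p *P (q +P s)) ≈P ((p *P q) +P (p *P s))
  *P-distribˡ p q s n = begin
    coeff (p *P (q +P s)) n                               ≈⟨ coeff-*P p (q +P s) n ⟩
    (coeff p ⋆ coeff (q +P s)) n                          ≈⟨ Σ≤-cong n (λ i _ → trans (*-congˡ (coeff-+P q s (n ∸ i))) (distribˡ _ _ _)) ⟩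
    Coeff.Σ≤ n (λ i → coeff p i * coeff q (n ∸ i) + coeff p i * coeff s (n ∸ i))
                                                          ≈⟨ Σ≤-distrib-+ n _ _ ⟩
    (coeff p ⋆ coeff q) n + (coeff p ⋆ coeff s) n         ≈⟨ +-cong (coeff-*P p q n) (coeff-*P p s n) ⟨
    coeff (p *P q) n + coeff (p *P s) n                   ≈⟨ coeff-+P (p *P q) (p *P s) n ⟨
    coeff ((p *P q) +P (p *P s)) n                        ∎

  polynomialRing : CommutativeRing c ℓ
  polynomialRing = record
    { Carrier = Poly ; _≈_ = _≃P_ ; _+_ = _+P_ ; _*_ = _*P_ ; -_ = -P_ ; 0# = 0P ; 1# = 1P
    ; isCommutativeRing = record
      { isRing = record
        { +-isAbelianGroup = record
          { isGroup = record
            { isMonoid = record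
              { isSemigroup = record
                { isMagma = record
                  { isEquivalence = record
                    { refl  = ⟨ (λ _ → refl) ⟩
                    ; sym   = λ { ⟨ p≈q ⟩ → ⟨ (λ n → sym (p≈q n)) ⟩ }
                    ; trans = λ { ⟨ p≈q ⟩ ⟨ q≈s ⟩ → ⟨ (λ n → trans (p≈q n) (q≈s n)) ⟩ } }
                  ; ∙-cong = λ {p} {p′} {q} {q′} p≈p′ q≈q′ → ⟨ +P-cong {p} {p′} {q} {q′} (coeff-≈ p≈p′) (coeff-≈ q≈q′) ⟩ }
                ; assoc = λ p q s → ⟨ (λ n → begin
                    coeff ((p +P q) +P s) n                ≈⟨ trans (coeff-+P (p +P q) s n) (+-congʳ (coeff-+P p q n)) ⟩
                    (coeff p n + coeff q n) + coeff s n    ≈⟨ +-assoc _ _ _ ⟩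
                    coeff p n + (coeff q n + coeff s n)    ≈⟨ +-congˡ (coeff-+P q s n) ⟨
                    coeff p n + coeff (q +P s) n           ≈⟨ coeff-+P p (q +P s) n ⟨
                    coeff (p +P (q +P s)) n                ∎) ⟩ }
              ; identity = (λ p → ⟨ (λ _ → refl) ⟩) , (λ p → ⟨ (λ n → trans (coeff-+P p [] n) (+-identityʳ _)) ⟩) }
            ; inverse = (λ p → ⟨ (λ n → trans (coeff-+P (-P p) p n) (trans (+-congʳ (coeff-negP p n)) (-‿inverseˡ _))) ⟩)
                      , (λ p → ⟨ (λ n → trans (coeff-+P p (-P p) n) (trans (+-congˡ (coeff-negP p n)) (-‿inverseʳ _))) ⟩)
            ; ⁻¹-cong = λ {p} {q} p≈q → ⟨ (λ n → trans (coeff-negP p n) (trans (-‿cong (coeff-≈ p≈q n)) (sym (coeff-negP q n)))) ⟩ }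
          ; comm = λ p q → ⟨ (λ n → trans (coeff-+P p q n) (trans (+-comm _ _) (sym (coeff-+P q p n)))) ⟩ }
        ; *-cong = λ {p} {p′} {q} {q′} p≈p′ q≈q′ → ⟨ *P-cong {p} {p′} {q} {q′} (coeff-≈ p≈p′) (coeff-≈ q≈q′) ⟩
        ; *-assoc = λ p q s → ⟨ *P-assoc p q s ⟩
        ; *-identity = (λ p → ⟨ *P-identityˡ p ⟩) , (λ p → ⟨ (λ n → trans (*P-comm p 1P n) (*P-identityˡ p n)) ⟩)
        ; distrib = (λ p q s → ⟨ *P-distribˡ p q s ⟩)
                  , (λ p q s → ⟨ (λ n → trans (*P-comm (q +P s) p n) (trans (*P-distribˡ p q s n)
                                   (+P-cong {p *P q} {q *P p} {p *P s} {s *P p} (*P-comm p q) (*P-comm p s) n))) ⟩) }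
      ; *-comm = λ p q → ⟨ *P-comm p q ⟩ } }

  _≟_ : (x y : Carrier) → Dec (x ≈ y)
  x ≟ y with enum-surj x | enum-surj y
  ... | i , eᵢ≈x | j , eⱼ≈y with i Fin.≟ j
  ...   | yes ≡.refl = yes (trans (sym eᵢ≈x) eⱼ≈y)
  ...   | no i≢j     = no (λ x≈y → i≢j (enum-inj i j (trans eᵢ≈x (trans x≈y (sym eⱼ≈y)))))

  NonZeroP : Poly → Set ℓ
  NonZeroP p = ¬ (p ≈P 0P)

  ≈0P? : (p : Poly) → Dec (p ≈P 0P)
  ≈0P? []      = yes (λ _ → refl)
  ≈0P? (a ∷ p) with a ≟ 0# | ≈0P? p
  ... | yes a≈0 | yes p≈0 = yes (λ { zero → a≈0 ; (suc n) → p≈0 n })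
  ... | no a≉0  | _       = no (λ a∷p≈0 → a≉0 (a∷p≈0 0))
  ... | yes _   | no p≉0  = no (λ a∷p≈0 → p≉0 (a∷p≈0 ∘ suc))

  Degree : Poly → ℕ → Set ℓ
  Degree p i = ¬ (coeff p i ≈ 0#) × (∀ j → i < j → coeff p j ≈ 0#)

  degree : ∀ p → NonZeroP p → Σ ℕ (Degree p)
  degree []      p≉0 = ⊥-elim (p≉0 (λ _ → refl))
  degree (a ∷ p) a∷p≉0 with ≈0P? p
  ... | yes p≈0 = 0 , (λ a≈0 → a∷p≉0 (λ { zero → a≈0 ; (suc n) → p≈0 n })) , (λ { (suc j) _ → p≈0 j })
  ... | no p≉0 with degree p p≉0
  ...   | i , pᵢ≉0 , above = suc i , pᵢ≉0 , (λ { (suc j) (s≤s i<j) → above j i<j })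

  coeff-*P-top : ∀ p q {i j} → (∀ t → i < t → coeff p t ≈ 0#) → (∀ t → j < t → coeff q t ≈ 0#) →
                 coeff (p *P q) (i ℕ.+ j) ≈ coeff p i * coeff q j
  coeff-*P-top p q {i} {j} p-above q-above = begin
    coeff (p *P q) (i ℕ.+ j)               ≈⟨ coeff-*P p q (i ℕ.+ j) ⟩
    (coeff p ⋆ coeff q) (i ℕ.+ j)          ≈⟨ Σ≤-single (i ℕ.+ j) i _ (ℕₚ.m≤m+n i j) vanish ⟩
    coeff p i * coeff q (i ℕ.+ j ∸ i)      ≈⟨ *-congˡ (reflexive (≡.cong (coeff q) (ℕₚ.m+n∸m≡n i j))) ⟩
    coeff p i * coeff q j                  ∎
    where
    vanish : ∀ t → t ≤ i ℕ.+ j → t ≢ i → coeff p t * coeff q (i ℕ.+ j ∸ t) ≈ 0#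
    vanish t _ t≢i with ℕₚ.<-cmp t i
    ... | tri≈ _ t≡i _ = ⊥-elim (t≢i t≡i)
    ... | tri> _ _ i<t = trans (*-congʳ (p-above t i<t)) (zeroˡ _)
    ... | tri< t<i _ _ = trans (*-congˡ (q-above _ j<i+j∸t)) (zeroʳ _)
      where
      j<i+j∸t : j < i ℕ.+ j ∸ t
      j<i+j∸t = ≡.subst (j <_) (≡.sym (ℕₚ.+-∸-comm j (ℕₚ.<⇒≤ t<i))) (ℕₚ.m<n+m j (ℕₚ.m<n⇒0<n∸m t<i))

  x*y≈0⇒y≈0 : ∀ {x y} → ¬ (x ≈ 0#) → x * y ≈ 0# → y ≈ 0#
  x*y≈0⇒y≈0 {x} {y} x≉0 xy≈0 with inverse x x≉0
  ... | z , xz≈1 = begin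
    y            ≈⟨ *-identityˡ y ⟨
    1# * y       ≈⟨ *-congʳ xz≈1 ⟨
    (x * z) * y  ≈⟨ xy∙z≈y∙xz x z y ⟩
    z * (x * y)  ≈⟨ *-congˡ xy≈0 ⟩
    z * 0#       ≈⟨ zeroʳ z ⟩
    0#           ∎

  *P-nonZero : ∀ p q → NonZeroP p → NonZeroP q → NonZeroP (p *P q)
  *P-nonZero p q p≉0 q≉0 pq≈0 with degree p p≉0 | degree q q≉0
  ... | i , pᵢ≉0 , p-above | j , qⱼ≉0 , q-above =
    qⱼ≉0 (x*y≈0⇒y≈0 pᵢ≉0 (trans (sym (coeff-*P-top p q p-above q-above)) (pq≈0 (i ℕ.+ j))))

  *P-cancelʳ-≈0P : ∀ {p d} → NonZeroP d → (p *P d) ≈P 0P → p ≈P 0P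
  *P-cancelʳ-≈0P {p} {d} d≉0 pd≈0 with ≈0P? p
  ... | yes p≈0 = p≈0
  ... | no p≉0  = ⊥-elim (*P-nonZero p d p≉0 d≉0 pd≈0)

  1P-nonZero : NonZeroP 1P
  1P-nonZero 1≈0 = 0≉1 (sym (1≈0 0))

  ^P-nonZero : ∀ p n → NonZeroP p → NonZeroP (p ^P n)
  ^P-nonZero p zero    p≉0 = 1P-nonZero
  ^P-nonZero p (suc n) p≉0 = *P-nonZero p (p ^P n) p≉0 (^P-nonZero p n p≉0)

  coeff-TP*P : ∀ q n → coeff (TP *P q) (suc n) ≈ coeff q n
  coeff-TP*P q n = begin
    coeff (TP *P q) (suc n)      ≈⟨ coeff-*P TP q (suc n) ⟩
    (coeff TP ⋆ coeff q) (suc n) ≈⟨ Σ≤-single (suc n) 1 _ (s≤s z≤n) vanish ⟩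
    1# * coeff q n               ≈⟨ *-identityˡ _ ⟩
    coeff q n                    ∎
    where
    vanish : ∀ i → i ≤ suc n → i ≢ 1 → coeff TP i * coeff q (suc n ∸ i) ≈ 0#
    vanish zero          _ _   = zeroˡ _
    vanish (suc zero)    _ i≢1 = ⊥-elim (i≢1 ≡.refl)
    vanish (suc (suc _)) _ _   = zeroˡ _

  coeff-TP^P : ∀ N → coeff (TP ^P N) N ≈ 1#
  coeff-TP^P zero    = refl
  coeff-TP^P (suc N) = trans (coeff-TP*P (TP ^P N) N) (coeff-TP^P N)

  TP^P-TP-nonZero : ∀ N → 2 ≤ N → NonZeroP ((TP ^P N) +P (-P TP))
  TP^P-TP-nonZero (suc zero) (s≤s ())
  TP^P-TP-nonZero N@(suc (suc _)) _ T^N-T≈0 = 0≉1 (sym (begin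
    1#                                      ≈⟨ +-identityʳ 1# ⟨
    1# + 0#                                 ≈⟨ +-cong (coeff-TP^P N) (trans (coeff-negP TP N) -0#≈0#) ⟨
    coeff (TP ^P N) N + coeff (-P TP) N     ≈⟨ coeff-+P (TP ^P N) (-P TP) N ⟨
    coeff ((TP ^P N) +P (-P TP)) N          ≈⟨ T^N-T≈0 N ⟩
    0#                                      ∎))

  module _ (2≤r : 2 ≤ r) where

    2≤r^[1+i] : ∀ i → 2 ≤ r ℕ.^ suc i
    2≤r^[1+i] i = ℕₚ.*-mono-≤ 2≤r (ℕₚ.m^n>0 r {{ℕ.>-nonZero (ℕₚ.<-≤-trans (s≤s z≤n) 2≤r)}} i)

    Dpoly-nonZero : ∀ i → NonZeroP (Dpoly i)
    Dpoly-nonZero zero    = 1P-nonZero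
    Dpoly-nonZero (suc i) = *P-nonZero (bracket (suc i)) (Dpoly i ^P r)
      (TP^P-TP-nonZero (r ℕ.^ suc i) (2≤r^[1+i] i)) (^P-nonZero (Dpoly i) r (Dpoly-nonZero i))

    Πaux-nonZero : ∀ fuel j n → NonZeroP (Πaux fuel j n)
    Πaux-nonZero zero       j n = 1P-nonZero
    Πaux-nonZero (suc fuel) j n = *P-nonZero (Dpoly j ^P modR n r) (Πaux fuel (suc j) (divR n r))
      (^P-nonZero (Dpoly j) (modR n r) (Dpoly-nonZero j)) (Πaux-nonZero fuel (suc j) (divR n r))

    CarlitzΠ-nonZero : ∀ n → NonZeroP (CarlitzΠ n)
    CarlitzΠ-nonZero n = Πaux-nonZero (suc n) 0 n

module RationalFunctions {c ℓ : Level} (r : ℕ) (F : FiniteField c ℓ r) where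
  open FiniteField F using (refl; sym)
  open Carlitz r F
  open Polynomials r F
  open CrossMultiplication polynomialRing
  open _≃P_
  module P = CommutativeRing polynomialRing

  ValidK : Set (c ⊔ ℓ)
  ValidK = Σ K Valid

  infix  4 _≃K_
  infixl 7 _*V_
  infixl 6 _+V_

  record _≃K_ (x y : ValidK) : Set ℓ where
    constructor ⟪_⟫
    field cross-≈ : proj₁ x ≈K proj₁ y
  open _≃K_ public

  _+V_ _*V_ : ValidK → ValidK → ValidK
  (x , x-valid) +V (y , y-valid) = (x +K y) , *P-nonZero (den x) (den y) x-valid y-valid
  (x , x-valid) *V (y , y-valid) = (x *K y) , *P-nonZero (den x) (den y) x-valid y-valid

  -V_ : ValidK → ValidK
  -V (x , x-valid) = (-K x) , x-valid

  0V 1V : ValidK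
  0V = 0K , 1P-nonZero
  1V = 1K , 1P-nonZero

  private
    numV denV : ValidK → Poly
    numV = num ∘ proj₁
    denV = den ∘ proj₁

  ≃K-trans : ∀ {x y z} → x ≃K y → y ≃K z → x ≃K z
  ≃K-trans {x} {y , y-valid} {z} ⟪ x≈y ⟫ ⟪ y≈z ⟫ = ⟪ coeff-≈ (cross-trans {numV x} {denV x} {num y} {den y} {numV z} {denV z}
    (λ {p} p*d≈0 → ⟨ *P-cancelʳ-≈0P {p} {den y} y-valid (coeff-≈ p*d≈0) ⟩) ⟨ x≈y ⟩ ⟨ y≈z ⟩) ⟫

  fractionRing : CommutativeRing (c ⊔ ℓ) ℓ
  fractionRing = record
    { Carrier = ValidK ; _≈_ = _≃K_ ; _+_ = _+V_ ; _*_ = _*V_ ; -_ = -V_ ; 0# = 0V ; 1# = 1V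
    ; isCommutativeRing = record
      { isRing = record
        { +-isAbelianGroup = record
          { isGroup = record
            { isMonoid = record
              { isSemigroup = record
                { isMagma = record
                  { isEquivalence = record
                    { refl  = ⟪ (λ _ → refl) ⟫
                    ; sym   = λ { ⟪ x≈y ⟫ → ⟪ (λ k → sym (x≈y k)) ⟫ }
                    ; trans = ≃K-trans }
                  ; ∙-cong = λ {x} {x′} {y} {y′} x≈x′ y≈y′ → lift (cross-+-cong (numV x) (denV x) (numV x′) (denV x′) (numV y) (denV y) (numV y′) (denV y′)
                                                                  ⟨ cross-≈ x≈x′ ⟩ ⟨ cross-≈ y≈y′ ⟩) }
                ; assoc = λ x y z → lift (cross-+-assoc (numV x) (denV x) (numV y) (denV y) (numV z) (denV z)) }
              ; identity = (λ x → lift (cross-+-identityˡ (numV x) (denV x))) , (λ x → lift (cross-+-identityʳ (numV x) (denV x))) }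
            ; inverse = (λ x → lift (cross-neg-inverseˡ (numV x) (denV x))) , (λ x → lift (cross-neg-inverseʳ (numV x) (denV x)))
            ; ⁻¹-cong = λ {x} {y} x≈y → lift (cross-neg-cong (numV x) (denV x) (numV y) (denV y) ⟨ cross-≈ x≈y ⟩) }
          ; comm = λ x y → lift (cross-+-comm (numV x) (denV x) (numV y) (denV y)) }
        ; *-cong = λ {x} {x′} {y} {y′} x≈x′ y≈y′ → lift (cross-*-cong (numV x) (denV x) (numV x′) (denV x′) (numV y) (denV y) (numV y′) (denV y′)
                                                         ⟨ cross-≈ x≈x′ ⟩ ⟨ cross-≈ y≈y′ ⟩)
        ; *-assoc = λ x y z → lift (cross-*-assoc (numV x) (denV x) (numV y) (denV y) (numV z) (denV z))
        ; *-identity = (λ x → lift (cross-*-identityˡ (numV x) (denV x))) , (λ x → lift (cross-*-identityʳ (numV x) (denV x)))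
        ; distrib = (λ x y z → lift (cross-distribˡ (numV x) (denV x) (numV y) (denV y) (numV z) (denV z)))
                  , (λ x y z → lift (cross-distribʳ (numV x) (denV x) (numV y) (denV y) (numV z) (denV z))) }
      ; *-comm = λ x y → lift (cross-*-comm (numV x) (denV x) (numV y) (denV y)) } }
    where
    lift : ∀ {x y : ValidK} → (numV x *P denV y) ≃P (numV y *P denV x) → x ≃K y
    lift ⟨ x≈y ⟩ = ⟪ x≈y ⟫

  module KS = FormalPowerSeries fractionRing
  module KH = HessenbergDeterminants fractionRing

  ≃K-from-≈K : ∀ {x y u w} → proj₁ x ≡ u → proj₁ y ≡ w → u ≈K w → x ≃K y
  ≃K-from-≈K ≡.refl ≡.refl u≈w = ⟪ u≈w ⟫

  ≈K-from-≃K : ∀ {x y u w} → proj₁ x ≡ u → proj₁ y ≡ w → x ≃K y → u ≈K w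
  ≈K-from-≃K ≡.refl ≡.refl ⟪ x≈y ⟫ = x≈y

  proj₁-Σ≤ : ∀ n f → proj₁ (KS.Σ≤ n f) ≡ Σ≤ n (proj₁ ∘ f)
  proj₁-Σ≤ zero    f = ≡.refl
  proj₁-Σ≤ (suc n) f = ≡.cong (_+K proj₁ (f (suc n))) (proj₁-Σ≤ n f)

  proj₁-⋆ : ∀ f g n → proj₁ ((f KS.⋆ g) n) ≡ ((proj₁ ∘ f) *PS (proj₁ ∘ g)) n
  proj₁-⋆ f g n = proj₁-Σ≤ n _

  proj₁-one : ∀ n → proj₁ (KS.one n) ≡ unitPS n
  proj₁-one zero    = ≡.refl
  proj₁-one (suc n) = ≡.refl

  Σ≤-≡ : ∀ n {f g : ℕ → K} → (∀ i → f i ≡ g i) → Σ≤ n f ≡ Σ≤ n g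
  Σ≤-≡ zero    f≡g = f≡g 0
  Σ≤-≡ (suc n) f≡g = ≡.cong₂ _+K_ (Σ≤-≡ n f≡g) (f≡g (suc n))

  proj₁-^⋆ : ∀ f l n → proj₁ ((f KS.^⋆ l) n) ≡ ((proj₁ ∘ f) ^PS l) n
  proj₁-^⋆ f zero    n = proj₁-one n
  proj₁-^⋆ f (suc l) n = ≡.trans (proj₁-⋆ f (f KS.^⋆ l) n) (Σ≤-≡ n λ i → ≡.cong (proj₁ (f i) *K_) (proj₁-^⋆ f l (n ∸ i)))

  proj₁-^⋆-Dℓ : ∀ f l n → proj₁ ((f KS.^⋆ l) n) ≡ Dℓ (proj₁ ∘ f) l n
  proj₁-^⋆-Dℓ f zero    zero    = ≡.refl
  proj₁-^⋆-Dℓ f zero    (suc n) = ≡.refl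
  proj₁-^⋆-Dℓ f (suc l) n = ≡.trans (proj₁-⋆ f (f KS.^⋆ l) n) (Σ≤-≡ n λ i → ≡.cong (proj₁ (f i) *K_) (proj₁-^⋆-Dℓ f l (n ∸ i)))

  proj₁-negOnePow : ∀ k → proj₁ (KH.negOnePow k) ≡ negOnePow k
  proj₁-negOnePow zero    = ≡.refl
  proj₁-negOnePow (suc k) = ≡.cong -K_ (proj₁-negOnePow k)

  proj₁-ΣFin : ∀ {m} f g → (∀ j → proj₁ (f j) ≡ g j) → proj₁ (KH.ΣFin {m} f) ≡ ΣFin g
  proj₁-ΣFin {zero}  f g f≡g = ≡.refl
  proj₁-ΣFin {suc m} f g f≡g = ≡.cong₂ _+K_ (f≡g Fin.zero) (proj₁-ΣFin (f ∘ Fin.suc) (g ∘ Fin.suc) (f≡g ∘ Fin.suc))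

  proj₁-det : ∀ m A B → (∀ i j → proj₁ (A i j) ≡ B i j) → proj₁ (KH.det m A) ≡ det m B
  proj₁-det zero    A B A≡B = ≡.refl
  proj₁-det (suc m) A B A≡B = proj₁-ΣFin cofactorA _ λ j →
    ≡.cong₂ _*K_ (proj₁-negOnePow (toℕ j)) (≡.cong₂ _*K_ (A≡B Fin.zero j) (proj₁-det m (minor A j) (minor B j) (λ i k → A≡B (Fin.suc i) (punchIn j k))))
    where
    minor : ∀ {x} {X : Set x} → (Fin (suc m) → Fin (suc m) → X) → Fin (suc m) → Fin m → Fin m → X
    minor M j i k = M (Fin.suc i) (punchIn j k)

    cofactorA : Fin (suc m) → ValidK
    cofactorA j = KH.negOnePow (toℕ j) *V (A Fin.zero j *V KH.det m (minor A j))

  proj₁-hessenberg : ∀ h g → (∀ i → proj₁ (h i) ≡ g i) → ∀ m i j → proj₁ (KH.hessenberg h m i j) ≡ hessMatrix g m i j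
  proj₁-hessenberg h g h≡g m i j with toℕ j ≤ᵇ toℕ i
  ... | true  = h≡g _
  ... | false with toℕ j ≡ᵇ suc (toℕ i)
  ...   | true  = ≡.refl
  ...   | false = ≡.refl

  1P-^P : ∀ k → (1P ^P k) ≃P 1P
  1P-^P zero    = P.refl
  1P-^P (suc k) = P.trans (P.*-congˡ {1P} (1P-^P k)) (P.*-identityˡ 1P)

  module Factorials (2≤r : 2 ≤ r) where
    open CommutativeRing fractionRing using (*-cong; *-congˡ; *-congʳ; *-assoc; *-identityˡ; *-identityʳ; setoid)
    open import Relation.Binary.Reasoning.Setoid setoid

    Π⁻¹ Πᵥ : ℕ → ValidK
    Π⁻¹ k = invK (Πk k) , CarlitzΠ-nonZero 2≤r k
    Πᵥ k  = Πk k , 1P-nonZero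

    -- Π(0) unfolds to D₀ ^ (0 mod r) · 1, and 0 mod r does not compute for a variable r.
    Π⁻¹-zero : Π⁻¹ 0 ≃K 1V
    Π⁻¹-zero = ⟪ coeff-≈ (P.*-congˡ {1P} (P.sym (P.trans (P.*-congʳ (1P-^P (modR 0 r))) (P.*-identityʳ 1P)))) ⟫

    *Π⁻¹⇒*Π : ∀ {x y} k → x *V Π⁻¹ k ≃K y → x ≃K y *V Πᵥ k
    *Π⁻¹⇒*Π {x} {y} k x/Π≈y = begin
      x                       ≈⟨ *-identityʳ x ⟨
      x *V 1V                 ≈⟨ *-congˡ {x} {Π⁻¹ k *V Πᵥ k} {1V} ⟪ coeff-≈ (P.*-assoc 1P (CarlitzΠ k) 1P) ⟫ ⟨
      x *V (Π⁻¹ k *V Πᵥ k)    ≈⟨ *-assoc x (Π⁻¹ k) (Πᵥ k) ⟨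
      (x *V Π⁻¹ k) *V Πᵥ k    ≈⟨ *-congʳ {Πᵥ k} x/Π≈y ⟩
      y *V Πᵥ k               ∎

primePower⇒2≤ : ∀ {r} → IsPrimePower r → 2 ≤ r
primePower⇒2≤ (p , a , p-prime , 1≤a , ≡.refl) =
  ℕₚ.≤-trans (ℕ.nonTrivial⇒n>1 p {{prime⇒nonTrivial p-prime}})
    (ℕₚ.≤-trans (ℕₚ.≤-reflexive (≡.sym (ℕₚ.*-identityʳ p))) (ℕₚ.^-monoʳ-≤ p {{prime⇒nonZero p-prime}} 1≤a))

theorem4 : ∀ {c ℓ : Level} (r : ℕ) → IsPrimePower r → (F : FiniteField c ℓ r) →
    let open Carlitz r F in
    (AC : ℕ → K) → (∀ n → Valid (AC n)) → AC 0 ≈K 1K →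
    (lam : ℕ → K) → (∀ n → Valid (lam n)) → (∀ n → (Sser AC *PS lam) n ≈K unitPS n) →
    (l : ℕ) → (ACl : ℕ → K) → (∀ n → Valid (ACl n)) →
    (∀ n → (ACl n *K invK (Πk n)) ≈K (Sser AC ^PS l) n) →
    (m : ℕ) → 1 ≤ m →
    ACl m ≈K ((negOnePow m *K Πk m) *K det m (hessMatrix (Dℓ lam l) m))
theorem4 r r-primePower F AC AC-valid AC₀≈1 lam lam-valid S⋆lam≈unit l ACl ACl-valid ACl/Π≈Sˡ m _ =
  ≈K-from-≃K ≡.refl signedDet-≡ ACl≈signedDet
  where
  open Carlitz r F
  open RationalFunctions r F
  open Factorials (primePower⇒2≤ r-primePower)
  module V = CommutativeRing fractionRing
  open import Algebra.Properties.CommutativeSemigroup V.*-commutativeSemigroup using (xy∙z≈xz∙y)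
  open import Relation.Binary.Reasoning.Setoid V.setoid

  S lam′ : KS.Series
  S k    = (AC k , AC-valid k) *V Π⁻¹ k
  lam′ k = lam k , lam-valid k

  S⋆lam′≐one : S KS.⋆ lam′ KS.≐ KS.one
  S⋆lam′≐one k = ≃K-from-≈K (proj₁-⋆ S lam′ k) (proj₁-one k) (S⋆lam≈unit k)

  S₀≈1 : S 0 ≃K 1V
  S₀≈1 = V.trans (V.*-cong {AC 0 , AC-valid 0} {1V} {Π⁻¹ 0} {1V} ⟪ AC₀≈1 ⟫ Π⁻¹-zero) (V.*-identityˡ 1V)

  ACl≈signedDet : (ACl m , ACl-valid m) ≃K (KH.negOnePow m *V Πᵥ m) *V KH.hessenbergDet (lam′ KS.^⋆ l) m
  ACl≈signedDet = begin
    ACl′                              ≈⟨ *Π⁻¹⇒*Π {ACl′} {(S KS.^⋆ l) m} m (≃K-from-≈K ≡.refl (proj₁-^⋆ S l m) (ACl/Π≈Sˡ m)) ⟩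
    (S KS.^⋆ l) m *V Πᵥ m             ≈⟨ V.*-congʳ {Πᵥ m} (KH.^⋆-inverse-hessenbergDet {S} {lam′} S⋆lam′≐one S₀≈1 l m) ⟩
    KH.negOnePow m *V hessDet *V Πᵥ m ≈⟨ xy∙z≈xz∙y (KH.negOnePow m) hessDet (Πᵥ m) ⟩
    KH.negOnePow m *V Πᵥ m *V hessDet ∎
    where
    ACl′ hessDet : ValidK
    ACl′    = ACl m , ACl-valid m
    hessDet = KH.hessenbergDet (lam′ KS.^⋆ l) m

  signedDet-≡ : proj₁ ((KH.negOnePow m *V Πᵥ m) *V KH.hessenbergDet (lam′ KS.^⋆ l) m)
                ≡ (negOnePow m *K Πk m) *K det m (hessMatrix (Dℓ lam l) m)
  signedDet-≡ = ≡.cong₂ _*K_ (≡.cong (_*K Πk m) (proj₁-negOnePow m))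
    (proj₁-det m _ _ (proj₁-hessenberg (lam′ KS.^⋆ l) (Dℓ lam l) (proj₁-^⋆-Dℓ lam′ l) m))
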